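{- Let $k\ge 3$ be an integer. (1) Let $T$ be the $3\times 2k$ array on the symbols $\{0,1,\dots,3k-1\}$ in which, for $0\le a<k$ and $0\le b<3$, the symbol $3a+b$ is placed in cell $(b+1,\ a+1)$ and in cell $\big((b+1)\bmod 3 + 1,\ k + ((a+b)\bmod k) + 1\big)$ (cells indexed as (row, column), rows $1,2,3$, columns $1,\dots,2k$). Then $T$ is a $(3\times 2k, 3k)$-near triple array. (2) Let $T'$ be the $3\times(2k+1)$ array on $3k+2$ symbols obtained from $T$ by replacing the symbol $0$ in cell $(1,1)$ by the symbol $3k$ and appending a new column $2k+1$ with entries $T'_{1,2k+1}=0$, $T'_{2,2k+1}=3k$, $T'_{3,2k+1}=3k+1$. Then $T'$ is a $(3\times(2k+1), 3k+2)$-near triple array.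
   Context: An $r\times c$ row-column design on $v$ symbols is an $r\times c$ array each of whose cells is filled with one of $v$ symbols. It is binary if no symbol occurs more than once in any row or in any column. Let $e=rc/v$, $e^-=\lfloor e\rfloor$, $e^+=\lceil e\rceil$. The design is equireplicate if $e$ is an integer and every symbol occurs exactly $e$ times, and near equireplicate if $e$ is not an integer and every symbol occurs $e^-$ or $e^+$ times. For a binary design, let $R_i$, $C_j$ be the symbol sets of row $i$ and column $j$, and put $\lambda_{rc}=\frac{1}{rc}\sum_{i,j}|R_i\cap C_j|$, $\lambda_{rr}=\binom{r}{2}^{ -1}\sum_{i<j}|R_i\cap R_j|$, $\lambda_{cc}=\binom{c}{2}^{ -1}\sum_{i<j}|C_i\cap C_j|$; for real $x$, $x^-=\lfloor x\rfloor$, $x^+=\lceil x\rceil$. An $(r\times c,v)$-near triple array is a binary $r\times c$ row-column design on $v$ symbols which is equireplicate or near equireplicate and in which every row and column share $\lambda_{rc}^-$ or $\lambda_{rc}^+$ symbols, every two distinct rows share $\lambda_{rr}^-$ or $\lambda_{rr}^+$ symbols, and every two distinct columns share $\lambda_{cc}^-$ or $\lambda_{cc}^+$ symbols. -}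

module Defs where

open import Data.Nat using (ℕ; zero; suc; _+_; _*_; _∸_; _<_; _≤_; _<?_; _≡ᵇ_; _<ᵇ_; NonZero; s≤s; z≤n)
open import Data.Nat.DivMod using (_/_; _%_)
open import Data.Nat.Properties using (m<m+n; m≤n+m; <-≤-trans; +-monoʳ-<)
open import Data.Nat.Combinatorics using (_C_)
open import Data.Bool using (Bool; true; false; if_then_else_; _∧_; _∨_)
open import Data.Fin using (Fin; toℕ; fromℕ<; _↑ˡ_)
import Data.Fin as Fin
open import Data.Fin.Properties using (_≟_)
open import Data.Product using (_×_; Σ)
open import Data.Sum using (_⊎_)
open import Relation.Nullary using (¬_; yes; no)
open import Relation.Nullary.Decidable using (⌊_⌋)
open import Relation.Binary.PropositionalEquality using (_≡_; _≢_)
open import Function using (_∘_)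

-- An r × c row-column design on v symbols (0-indexed rows, columns, symbols).
Design : ℕ → ℕ → ℕ → Set
Design r c v = Fin r → Fin c → Fin v

sumF : (n : ℕ) → (Fin n → ℕ) → ℕ
sumF zero f = 0
sumF (suc n) f = f Fin.zero + sumF n (f ∘ Fin.suc)

countF : (n : ℕ) → (Fin n → Bool) → ℕ
countF n p = sumF n (λ x → if p x then 1 else 0)

anyF : (n : ℕ) → (Fin n → Bool) → Bool
anyF zero p = false
anyF (suc n) p = p Fin.zero ∨ anyF n (p ∘ Fin.suc)

module _ {r c v : ℕ} (A : Design r c v) where

  Binary : Set
  Binary = (∀ i j j' → j ≢ j' → A i j ≢ A i j')
         × (∀ j i i' → i ≢ i' → A i j ≢ A i' j)

  rep : Fin v → ℕ
  rep s = sumF r (λ i → countF c (λ j → ⌊ A i j ≟ s ⌋))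

  inRow : Fin r → Fin v → Bool
  inRow i s = anyF c (λ j → ⌊ A i j ≟ s ⌋)

  inCol : Fin c → Fin v → Bool
  inCol j s = anyF r (λ i → ⌊ A i j ≟ s ⌋)

  rowCol : Fin r → Fin c → ℕ
  rowCol i j = countF v (λ s → inRow i s ∧ inCol j s)

  rowRow : Fin r → Fin r → ℕ
  rowRow i i' = countF v (λ s → inRow i s ∧ inRow i' s)

  colCol : Fin c → Fin c → ℕ
  colCol j j' = countF v (λ s → inCol j s ∧ inCol j' s)

  -- numerators of λ_rc, λ_rr, λ_cc (sums over i,j resp. over pairs i<j)
  sumRC : ℕ
  sumRC = sumF r (λ i → sumF c (λ j → rowCol i j))

  sumRR : ℕ
  sumRR = sumF r (λ i → sumF r (λ i' → if toℕ i <ᵇ toℕ i' then rowRow i i' else 0))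

  sumCC : ℕ
  sumCC = sumF c (λ j → sumF c (λ j' → if toℕ j <ᵇ toℕ j' then colCol j j' else 0))

-- floor and ceiling of the rational number S / N (convention: 0 when N = 0)
floorDiv : ℕ → ℕ → ℕ
floorDiv S zero = 0
floorDiv S (suc n) = S / suc n

ceilDiv : ℕ → ℕ → ℕ
ceilDiv S zero = 0
ceilDiv S (suc n) = (S + n) / suc n

FloorOrCeil : ℕ → ℕ → ℕ → Set
FloorOrCeil x S N = (x ≡ floorDiv S N) ⊎ (x ≡ ceilDiv S N)

NearTripleArray : (r c v : ℕ) → Design r c v → Set
NearTripleArray r c v A =
    Binary A
  × (∀ s → FloorOrCeil (rep A s) (r * c) v)
  × (∀ i j → FloorOrCeil (rowCol A i j) (sumRC A) (r * c))
  × (∀ i i' → i ≢ i' → FloorOrCeil (rowRow A i i') (sumRR A) (r C 2))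
  × (∀ j j' → j ≢ j' → FloorOrCeil (colCol A j j') (sumCC A) (c C 2))

-- The placement conditions defining T (0-indexed: row b, column a, etc.)
-- symbol 3a+b in cell (b, a) and in cell ((b+1) mod 3, k + ((a+b) mod k)).
IsT : (k : ℕ) .{{_ : NonZero k}} → Design 3 (2 * k) (3 * k) → Set
IsT k T = ∀ a b → a < k → b < 3 →
    (∀ i j → toℕ i ≡ b → toℕ j ≡ a → toℕ (T i j) ≡ 3 * a + b)
  × (∀ i j → toℕ i ≡ (b + 1) % 3 → toℕ j ≡ k + ((a + b) % k) → toℕ (T i j) ≡ 3 * a + b)

T' : (k : ℕ) → Design 3 (2 * k) (3 * k) → Design 3 (2 * k + 1) (3 * k + 2)
T' k T i j with toℕ j <? 2 * k
... | yes p = if (toℕ i ≡ᵇ 0) ∧ (toℕ j ≡ᵇ 0)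
                then fromℕ< (m<m+n (3 * k) (s≤s z≤n))
                else (T i (fromℕ< p)) ↑ˡ 2
... | no _ = lastCol i
  where
  lastCol : Fin 3 → Fin (3 * k + 2)
  lastCol Fin.zero = fromℕ< (<-≤-trans (s≤s z≤n) (m≤n+m 2 (3 * k)))         -- symbol 0
  lastCol (Fin.suc Fin.zero) = fromℕ< (m<m+n (3 * k) (s≤s z≤n))              -- symbol 3k
  lastCol (Fin.suc (Fin.suc Fin.zero)) = fromℕ< (+-monoʳ-< (3 * k) (s≤s (s≤s z≤n)))  -- symbol 3k+1

-- Write each symbol of T as 3a + b with a < k and b < 3.  A left column a of T is the block
-- {3a, 3a + 1, 3a + 2}, right column c collects the symbols with a + b ≡ c (mod k), and row i
-- consists of the symbols with b ≡ i or b ≡ i - 1 (mod 3), each exactly once.  Counting cells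
-- gives replication 2, row-column intersections of size 2 and row-row intersections of size k;
-- two columns share at most one symbol because, for k ≥ 3, the shifts a + b (mod k) separate the
-- three residues b.  Passing to T' moves the symbol 0 and adds 3k and 3k + 1, which changes each
-- of these counts by at most one.  Finally, whenever a statistic takes only the values a and
-- a + 1, its mean lies in [a, a + 1] and misses the end that is not attained, so every value is
-- the floor or the ceiling of the mean.
module Submission where

open import Defs
open import Data.Bool using (Bool; true; false; if_then_else_; _∧_; _∨_; T)
open import Data.Bool.Properties using (∧-comm; ∧-zeroʳ; ∧-identityʳ)
open import Data.Fin using (Fin; toℕ; fromℕ<; _↑ˡ_; _↑ʳ_; splitAt; join)
import Data.Fin as Fin
open import Data.Fin.Patterns using (0F; 1F; 2F)
open import Data.Fin.Properties
  using ( _≟_; toℕ-injective; suc-injective; join-splitAt; splitAt-↑ˡ; splitAt-↑ʳ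
        ; toℕ-↑ˡ; toℕ-↑ʳ; toℕ<n; toℕ-fromℕ<; ↑ˡ-injective; ↑ʳ-injective)
open import Data.Nat using (ℕ; zero; suc; _+_; _*_; _∸_; _≤_; _<_; _<ᵇ_; _<?_; _≡ᵇ_; NonZero; z≤n; s≤s)
open import Data.Nat.Combinatorics using (_C_; nC1≡n; nCk+nC[k+1]≡[n+1]C[k+1])
open import Data.Nat.DivMod
open import Data.Nat.Divisibility using (divides-refl)
open import Data.Nat.Properties hiding (_≟_; suc-injective)
open import Data.Nat.Properties using () renaming (_≟_ to _≟ℕ_)
open import Algebra.Properties.Semiring.Sum +-*-semiring using (sum; ∑-comm; ∑-distrib-+)
open import Data.Product using (_×_; Σ; _,_; proj₁; proj₂)
open import Data.Sum using (_⊎_; inj₁; inj₂)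
open import Data.Unit using (tt)
open import Function using (_∘_; flip)
open import Function.Definitions using (Injective)
open import Relation.Binary.Definitions using (Tri; tri<; tri≈; tri>)
open import Relation.Binary.PropositionalEquality
open import Relation.Nullary using (¬_; yes; no; contradiction)
open import Relation.Nullary.Decidable using (⌊_⌋)

𝟙 : Bool → ℕ
𝟙 b = if b then 1 else 0

𝟙≤1 : ∀ b → 𝟙 b ≤ 1
𝟙≤1 false = z≤n
𝟙≤1 true = s≤s z≤n

≟-sound : ∀ {n} {x y : Fin n} → ⌊ x ≟ y ⌋ ≡ true → x ≡ y
≟-sound {x = x} {y} e with x ≟ y
... | yes x≡y = x≡y

≟-complete : ∀ {n} {x y : Fin n} → x ≡ y → ⌊ x ≟ y ⌋ ≡ true
≟-complete {x = x} {y} x≡y with x ≟ y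
... | yes _ = refl
... | no x≢y = contradiction x≡y x≢y

≟-suc : ∀ {n} (x y : Fin n) → ⌊ Fin.suc x ≟ Fin.suc y ⌋ ≡ ⌊ x ≟ y ⌋
≟-suc x y with x ≟ y
... | yes _ = refl
... | no _ = refl

≡-from-true : ∀ {x y : Bool} → (x ≡ true → y ≡ true) → (y ≡ true → x ≡ true) → x ≡ y
≡-from-true {false} {false} _ _ = refl
≡-from-true {false} {true} _ y⇒x = y⇒x refl
≡-from-true {true} {_} x⇒y _ = sym (x⇒y refl)

-- Finite sums and counts

sumF≡sum : ∀ n (f : Fin n → ℕ) → sumF n f ≡ sum f
sumF≡sum zero f = refl
sumF≡sum (suc n) f = cong (f Fin.zero +_) (sumF≡sum n (f ∘ Fin.suc))

sumF-cong : ∀ n {f g : Fin n → ℕ} → (∀ x → f x ≡ g x) → sumF n f ≡ sumF n g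
sumF-cong zero eq = refl
sumF-cong (suc n) eq = cong₂ _+_ (eq Fin.zero) (sumF-cong n (eq ∘ Fin.suc))

sumF-const : ∀ n a → sumF n (λ _ → a) ≡ n * a
sumF-const zero a = refl
sumF-const (suc n) a = cong (a +_) (sumF-const n a)

*-distribˡ-sumF : ∀ n a (f : Fin n → ℕ) → a * sumF n f ≡ sumF n (λ x → a * f x)
*-distribˡ-sumF zero a f = *-zeroʳ a
*-distribˡ-sumF (suc n) a f =
  trans (*-distribˡ-+ a (f Fin.zero) _) (cong (a * f Fin.zero +_) (*-distribˡ-sumF n a (f ∘ Fin.suc)))

sumF-mono-≤ : ∀ n {f g : Fin n → ℕ} → (∀ x → f x ≤ g x) → sumF n f ≤ sumF n g
sumF-mono-≤ zero le = z≤n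
sumF-mono-≤ (suc n) le = +-mono-≤ (le Fin.zero) (sumF-mono-≤ n (le ∘ Fin.suc))

sumF-mono-< : ∀ n {f g : Fin n → ℕ} → (∀ x → f x ≤ g x) → ∀ x → f x < g x → sumF n f < sumF n g
sumF-mono-< (suc n) le Fin.zero lt = +-mono-<-≤ lt (sumF-mono-≤ n (le ∘ Fin.suc))
sumF-mono-< (suc n) le (Fin.suc x) lt = +-mono-≤-< (le Fin.zero) (sumF-mono-< n (le ∘ Fin.suc) x lt)

sumF-↑ : ∀ m n (f : Fin (m + n) → ℕ) → sumF (m + n) f ≡ sumF m (λ x → f (x ↑ˡ n)) + sumF n (λ y → f (m ↑ʳ y))
sumF-↑ zero n f = refl
sumF-↑ (suc m) n f = trans (cong (f Fin.zero +_) (sumF-↑ m n (f ∘ Fin.suc))) (sym (+-assoc (f Fin.zero) _ _))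

sumF-distrib-+ : ∀ n (f g : Fin n → ℕ) → sumF n (λ x → f x + g x) ≡ sumF n f + sumF n g
sumF-distrib-+ n f g = begin
  sumF n (λ x → f x + g x) ≡⟨ sumF≡sum n _ ⟩
  sum (λ x → f x + g x)    ≡⟨ ∑-distrib-+ f g ⟩
  sum f + sum g            ≡⟨ cong₂ _+_ (sumF≡sum n f) (sumF≡sum n g) ⟨
  sumF n f + sumF n g      ∎
  where open ≡-Reasoning

sumF-comm : ∀ m n (f : Fin m → Fin n → ℕ) →
            sumF m (λ x → sumF n (f x)) ≡ sumF n (λ y → sumF m (λ x → f x y))
sumF-comm m n f = begin
  sumF m (λ x → sumF n (f x))           ≡⟨ sumF²≡sum² m n f ⟩
  sum (λ x → sum (f x))                 ≡⟨ ∑-comm f ⟩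
  sum (λ y → sum (λ x → f x y))         ≡⟨ sumF²≡sum² n m (flip f) ⟨
  sumF n (λ y → sumF m (λ x → f x y))   ∎
  where
  open ≡-Reasoning
  sumF²≡sum² : ∀ m n (f : Fin m → Fin n → ℕ) → sumF m (λ x → sumF n (f x)) ≡ sum (λ x → sum (f x))
  sumF²≡sum² m n f = trans (sumF-cong m (λ x → sumF≡sum n (f x))) (sumF≡sum m _)

data ↑-View (m n : ℕ) : Fin (m + n) → Set where
  ↑ˡ-view : ∀ x → ↑-View m n (x ↑ˡ n)
  ↑ʳ-view : ∀ y → ↑-View m n (m ↑ʳ y)

↑-view : ∀ m n (z : Fin (m + n)) → ↑-View m n z
↑-view m n z = subst (↑-View m n) (join-splitAt m n z) (view (splitAt m z))
  where
  view : ∀ x → ↑-View m n (join m n x)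
  view (inj₁ x) = ↑ˡ-view x
  view (inj₂ y) = ↑ʳ-view y

↑ˡ≢↑ʳ : ∀ {m n} (x : Fin m) (y : Fin n) → x ↑ˡ n ≢ m ↑ʳ y
↑ˡ≢↑ʳ {m} {n} x y eq with trans (sym (splitAt-↑ˡ m x n)) (trans (cong (splitAt m) eq) (splitAt-↑ʳ m n y))
... | ()

↑ʳ≢↑ˡ : ∀ {m n} (y : Fin n) (x : Fin m) → m ↑ʳ y ≢ x ↑ˡ n
↑ʳ≢↑ˡ y x eq = ↑ˡ≢↑ʳ x y (sym eq)

anyF-witness : ∀ n (p : Fin n → Bool) → anyF n p ≡ true → Σ (Fin n) (λ x → p x ≡ true)
anyF-witness (suc n) p e with p Fin.zero in p0
... | true = Fin.zero , p0
... | false with anyF-witness n (p ∘ Fin.suc) e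
...   | x , px = Fin.suc x , px

anyF-intro : ∀ n (p : Fin n → Bool) x → p x ≡ true → anyF n p ≡ true
anyF-intro (suc n) p Fin.zero px rewrite px = refl
anyF-intro (suc n) p (Fin.suc x) px with p Fin.zero
... | true = refl
... | false = anyF-intro n (p ∘ Fin.suc) x px

countF-false : ∀ n (p : Fin n → Bool) → (∀ x → p x ≡ false) → countF n p ≡ 0
countF-false zero p h = refl
countF-false (suc n) p h rewrite h Fin.zero = countF-false n (p ∘ Fin.suc) (h ∘ Fin.suc)

countF-≤1 : ∀ n (p : Fin n → Bool) → (∀ x y → p x ≡ true → p y ≡ true → x ≡ y) → countF n p ≡ 𝟙 (anyF n p)
countF-≤1 zero p uniq = refl
countF-≤1 (suc n) p uniq with p Fin.zero in p0
... | true = cong suc (countF-false n (p ∘ Fin.suc) no-other)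
  where
  no-other : ∀ x → p (Fin.suc x) ≡ false
  no-other x with p (Fin.suc x) in px
  ... | false = refl
  ... | true with uniq _ _ p0 px
  ...   | ()
... | false = countF-≤1 n (p ∘ Fin.suc) (λ x y px py → suc-injective (uniq _ _ px py))

countF-≤1-at : ∀ n (p : Fin n → Bool) x₀ → (∀ x → p x ≡ true → x ≡ x₀) → countF n p ≤ 1
countF-≤1-at n p x₀ only = subst (_≤ 1) (sym (countF-≤1 n p (λ x y px py → trans (only x px) (sym (only y py))))) (𝟙≤1 _)

countF-∧-≡ : ∀ n (p : Fin n → Bool) x → countF n (λ y → p y ∧ ⌊ x ≟ y ⌋) ≡ 𝟙 (p x)
countF-∧-≡ (suc n) p Fin.zero rewrite ∧-identityʳ (p Fin.zero) =
  trans (cong (𝟙 (p Fin.zero) +_) (countF-false n _ (λ y → ∧-zeroʳ (p (Fin.suc y))))) (+-identityʳ _)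
countF-∧-≡ (suc n) p (Fin.suc x) =
  cong₂ (λ b → 𝟙 b +_) (∧-zeroʳ (p Fin.zero))
    (trans (sumF-cong n (λ y → cong (λ b → 𝟙 (p (Fin.suc y) ∧ b)) (≟-suc x y))) (countF-∧-≡ n (p ∘ Fin.suc) x))

countF-∧-image : ∀ v r (p : Fin v → Bool) (e : Fin r → Fin v) → Injective _≡_ _≡_ e →
                 countF v (λ s → p s ∧ anyF r (λ i → ⌊ e i ≟ s ⌋)) ≡ sumF r (λ i → 𝟙 (p (e i)))
countF-∧-image v zero p e inj = countF-false v _ (λ s → ∧-zeroʳ (p s))
countF-∧-image v (suc r) p e inj = begin
    countF v (λ s → p s ∧ (hit₀ s ∨ hit s))
  ≡⟨ sumF-cong v (λ s → 𝟙-∧-∨ (p s) (hit₀ s) (hit s) (disjoint s)) ⟩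
    sumF v (λ s → 𝟙 (p s ∧ hit₀ s) + 𝟙 (p s ∧ hit s))
  ≡⟨ sumF-distrib-+ v _ _ ⟩
    countF v (λ s → p s ∧ hit₀ s) + countF v (λ s → p s ∧ hit s)
  ≡⟨ cong₂ _+_ (countF-∧-≡ v p (e Fin.zero)) (countF-∧-image v r p (e ∘ Fin.suc) (suc-injective ∘ inj)) ⟩
    𝟙 (p (e Fin.zero)) + sumF r (λ i → 𝟙 (p (e (Fin.suc i))))
  ∎
  where
  open ≡-Reasoning
  hit₀ hit : Fin v → Bool
  hit₀ s = ⌊ e Fin.zero ≟ s ⌋
  hit s = anyF r (λ i → ⌊ e (Fin.suc i) ≟ s ⌋)
  disjoint : ∀ s → hit₀ s ≡ true → hit s ≡ false
  disjoint s h₀ with hit s in h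
  ... | false = refl
  ... | true with anyF-witness r _ h
  ...   | i , hi with inj (trans (≟-sound h₀) (sym (≟-sound hi)))
  ...     | ()
  𝟙-∧-∨ : ∀ a x y → (x ≡ true → y ≡ false) → 𝟙 (a ∧ (x ∨ y)) ≡ 𝟙 (a ∧ x) + 𝟙 (a ∧ y)
  𝟙-∧-∨ false x y _ = refl
  𝟙-∧-∨ true false y _ = refl
  𝟙-∧-∨ true true y x⇒¬y rewrite x⇒¬y refl = refl

-- Row and column statistics of a design

module _ {r c v : ℕ} (A : Design r c v) where

  binary : (∀ i → Injective _≡_ _≡_ (A i)) → (∀ j → Injective _≡_ _≡_ (λ i → A i j)) → Binary A
  binary rowInj colInj = (λ i j j' j≢j' eq → j≢j' (rowInj i eq))
                       , (λ j i i' i≢i' eq → i≢i' (colInj j eq))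

  inRow-intro : ∀ i j s → A i j ≡ s → inRow A i s ≡ true
  inRow-intro i j s eq = anyF-intro c _ j (≟-complete eq)

  inCol-intro : ∀ i j s → A i j ≡ s → inCol A j s ≡ true
  inCol-intro i j s eq = anyF-intro r _ i (≟-complete eq)

  inRow-elim : ∀ i s → inRow A i s ≡ true → Σ (Fin c) (λ j → A i j ≡ s)
  inRow-elim i s h with anyF-witness c _ h
  ... | j , hj = j , ≟-sound hj

  inCol-elim : ∀ j s → inCol A j s ≡ true → Σ (Fin r) (λ i → A i j ≡ s)
  inCol-elim j s h with anyF-witness r _ h
  ... | i , hi = i , ≟-sound hi

  inCol-false : ∀ j s → (∀ i → A i j ≢ s) → inCol A j s ≡ false
  inCol-false j s never with inCol A j s in h
  ... | false = refl
  ... | true = contradiction (proj₂ (inCol-elim j s h)) (never _)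

  rowCol-cells : ∀ i j → Injective _≡_ _≡_ (λ i' → A i' j) → rowCol A i j ≡ sumF r (λ i' → 𝟙 (inRow A i (A i' j)))
  rowCol-cells i j = countF-∧-image v r (inRow A i) (λ i' → A i' j)

  rowRow-cells : ∀ i i' → Injective _≡_ _≡_ (A i') → rowRow A i i' ≡ sumF c (λ j → 𝟙 (inRow A i (A i' j)))
  rowRow-cells i i' = countF-∧-image v c (inRow A i) (A i')

  colCol-cells : ∀ j j' → Injective _≡_ _≡_ (λ i → A i j') → colCol A j j' ≡ sumF r (λ i → 𝟙 (inCol A j (A i j')))
  colCol-cells j j' = countF-∧-image v r (inCol A j) (λ i → A i j')

  rep-rows : (∀ i → Injective _≡_ _≡_ (A i)) → ∀ s → rep A s ≡ sumF r (λ i → 𝟙 (inRow A i s))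
  rep-rows rowInj s = sumF-cong r (λ i → countF-≤1 c _ (λ j j' hj hj' → rowInj i (trans (≟-sound hj) (sym (≟-sound hj')))))

  sumF-rep : sumF v (rep A) ≡ r * c
  sumF-rep = begin
      sumF v (λ s → sumF r (λ i → countF c (λ j → ⌊ A i j ≟ s ⌋)))
    ≡⟨ sumF-comm v r _ ⟩
      sumF r (λ i → sumF v (λ s → countF c (λ j → ⌊ A i j ≟ s ⌋)))
    ≡⟨ sumF-cong r (λ i → sumF-comm v c _) ⟩
      sumF r (λ i → sumF c (λ j → countF v (λ s → ⌊ A i j ≟ s ⌋)))
    ≡⟨ sumF-cong r (λ i → sumF-cong c (λ j → countF-∧-≡ v (λ _ → true) (A i j))) ⟩
      sumF r (λ i → sumF c (λ j → 1))
    ≡⟨ sumF-cong r (λ i → trans (sumF-const c 1) (*-identityʳ c)) ⟩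
      sumF r (λ i → c)
    ≡⟨ sumF-const r c ⟩
      r * c
    ∎
    where open ≡-Reasoning

  rowRow-sym : ∀ i i' → rowRow A i i' ≡ rowRow A i' i
  rowRow-sym i i' = sumF-cong v (λ s → cong 𝟙 (∧-comm (inRow A i s) (inRow A i' s)))

  colCol-sym : ∀ j j' → colCol A j j' ≡ colCol A j' j
  colCol-sym j j' = sumF-cong v (λ s → cong 𝟙 (∧-comm (inCol A j s) (inCol A j' s)))

-- Floors and ceilings of means

floorDiv-≡ : ∀ {S N a} → a * N ≤ S → S < suc a * N → floorDiv S N ≡ a
floorDiv-≡ {S} {zero} {a} _ S<0 = contradiction (subst (S <_) (*-zeroʳ (suc a)) S<0) n≮0
floorDiv-≡ {S} {suc n} {a} aN≤S S<[1+a]N = ≤-antisym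
  (≤-pred (m<n*o⇒m/o<n S<[1+a]N))
  (subst (_≤ S / suc n) (m*n/n≡m a (suc n)) (/-monoˡ-≤ (suc n) aN≤S))

ceilDiv-≡ : ∀ {S N a} → a * N < S → S ≤ suc a * N → ceilDiv S N ≡ suc a
ceilDiv-≡ {S} {zero} {a} aN<S S≤0 = contradiction (subst₂ _<_ (*-zeroʳ a) (*-zeroʳ (suc a)) (<-≤-trans aN<S S≤0)) (n≮n 0)
ceilDiv-≡ {S} {suc n} {a} aN<S S≤[1+a]N = floorDiv-≡
  (subst (_≤ S + n) (cong suc (+-comm (a * suc n) n)) (+-monoˡ-≤ n aN<S))
  (subst (S + n <_) (cong suc (+-comm (suc a * suc n) n)) (s≤s (+-monoˡ-≤ n S≤[1+a]N)))

InBand : ℕ → ℕ → Set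
InBand a x = a ≤ x × x ≤ suc a

≡⇒InBand : ∀ {a x} → x ≡ a → InBand a x
≡⇒InBand {a} refl = ≤-refl , n≤1+n a

-- sumRC, sumRR and sumCC are definitionally sumOver with everything selected, resp. with _<ᶠ_.
sumOver : ∀ {m n} → (Fin m → Fin n → Bool) → (Fin m → Fin n → ℕ) → ℕ
sumOver {m} {n} sel f = sumF m (λ x → sumF n (λ y → if sel x y then f x y else 0))

module _ {m n : ℕ} (sel : Fin m → Fin n → Bool) where

  private
    masked-≤ : ∀ b {x y} → (T b → x ≤ y) → (if b then x else 0) ≤ (if b then y else 0)
    masked-≤ false _ = z≤n
    masked-≤ true x≤y = x≤y tt

  sumOver-mono-≤ : ∀ {f g} → (∀ x y → T (sel x y) → f x y ≤ g x y) → sumOver sel f ≤ sumOver sel g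
  sumOver-mono-≤ f≤g = sumF-mono-≤ m (λ x → sumF-mono-≤ n (λ y → masked-≤ (sel x y) (f≤g x y)))

  sumOver-mono-< : ∀ {f g} → (∀ x y → T (sel x y) → f x y ≤ g x y) →
                   ∀ x y → T (sel x y) → f x y < g x y → sumOver sel f < sumOver sel g
  sumOver-mono-< {f} {g} f≤g x y sxy fxy<gxy = sumF-mono-< m (λ x → sumF-mono-≤ n (λ y → masked-≤ (sel x y) (f≤g x y))) x
    (sumF-mono-< n (λ y → masked-≤ (sel x y) (f≤g x y)) y (masked-< (sel x y) sxy))
    where
    masked-< : ∀ b → T b → (if b then f x y else 0) < (if b then g x y else 0)
    masked-< true _ = fxy<gxy

  sumOver-const : ∀ a → sumOver sel (λ _ _ → a) ≡ a * sumOver sel (λ _ _ → 1)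
  sumOver-const a = sym (trans (*-distribˡ-sumF m a _)
    (sumF-cong m (λ x → trans (*-distribˡ-sumF n a _) (sumF-cong n (λ y → masked (sel x y))))))
    where
    masked : ∀ b → a * (if b then 1 else 0) ≡ (if b then a else 0)
    masked false = *-zeroʳ a
    masked true = *-identityʳ a

  -- The mean lies in [a, a + 1], strictly below a + 1 if some value is a and strictly above a
  -- if some value is a + 1.
  floorOrCeil-band : ∀ f a → (∀ x y → T (sel x y) → InBand a (f x y)) →
                     ∀ x y → T (sel x y) → FloorOrCeil (f x y) (sumOver sel f) (sumOver sel (λ _ _ → 1))
  floorOrCeil-band f a band x y sxy = classify (m≤n⇒m<n∨m≡n (proj₁ (band x y sxy)))
    where
    N S : ℕ
    N = sumOver sel (λ _ _ → 1)
    S = sumOver sel f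
    aN≤S : a * N ≤ S
    aN≤S = subst (_≤ S) (sumOver-const a) (sumOver-mono-≤ (λ x y s → proj₁ (band x y s)))
    S≤[1+a]N : S ≤ suc a * N
    S≤[1+a]N = subst (S ≤_) (sumOver-const (suc a)) (sumOver-mono-≤ (λ x y s → proj₂ (band x y s)))
    classify : a < f x y ⊎ a ≡ f x y → FloorOrCeil (f x y) S N
    classify (inj₂ a≡fxy) = inj₁ (trans (sym a≡fxy) (sym (floorDiv-≡ aN≤S S<[1+a]N)))
      where
      S<[1+a]N : S < suc a * N
      S<[1+a]N = subst (S <_) (sumOver-const (suc a))
        (sumOver-mono-< (λ x y s → proj₂ (band x y s)) x y sxy (≤-reflexive (cong suc (sym a≡fxy))))
    classify (inj₁ a<fxy) = inj₂ (trans (≤-antisym (proj₂ (band x y sxy)) a<fxy) (sym (ceilDiv-≡ aN<S S≤[1+a]N)))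
      where
      aN<S : a * N < S
      aN<S = subst (_< S) (sumOver-const a) (sumOver-mono-< (λ x y s → proj₁ (band x y s)) x y sxy a<fxy)

_<ᶠ_ : ∀ {n} → Fin n → Fin n → Bool
x <ᶠ y = toℕ x <ᵇ toℕ y

sumOver-<ᶠ-1 : ∀ n → sumOver {n} _<ᶠ_ (λ _ _ → 1) ≡ n C 2
sumOver-<ᶠ-1 zero = refl
sumOver-<ᶠ-1 (suc n) = begin
  sumF n (λ _ → 1) + sumOver {n} _<ᶠ_ (λ _ _ → 1) ≡⟨ cong₂ _+_ (trans (sumF-const n 1) (*-identityʳ n)) (sumOver-<ᶠ-1 n) ⟩
  n + n C 2                                       ≡⟨ cong (_+ n C 2) (nC1≡n n) ⟨
  n C 1 + n C 2                                   ≡⟨ nCk+nC[k+1]≡[n+1]C[k+1] n 1 ⟩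
  suc n C 2                                       ∎
  where open ≡-Reasoning

floorOrCeil-pairs : ∀ n (f : Fin n → Fin n → ℕ) a → (∀ x y → f x y ≡ f y x) →
                    (∀ x y → x ≢ y → InBand a (f x y)) →
                    ∀ x y → x ≢ y → FloorOrCeil (f x y) (sumOver _<ᶠ_ f) (n C 2)
floorOrCeil-pairs n f a f-sym band x y x≢y =
  subst (FloorOrCeil (f x y) (sumOver _<ᶠ_ f)) (sumOver-<ᶠ-1 n) (ordered (<-cmp (toℕ x) (toℕ y)))
  where
  mean : ∀ x y → T (x <ᶠ y) → FloorOrCeil (f x y) (sumOver _<ᶠ_ f) (sumOver {n} _<ᶠ_ (λ _ _ → 1))
  mean = floorOrCeil-band _<ᶠ_ f a (λ x y x<y → band x y (λ { refl → <-irrefl refl (<ᵇ⇒< (toℕ x) (toℕ x) x<y) }))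
  ordered : Tri (toℕ x < toℕ y) (toℕ x ≡ toℕ y) (toℕ y < toℕ x) →
            FloorOrCeil (f x y) (sumOver _<ᶠ_ f) (sumOver {n} _<ᶠ_ (λ _ _ → 1))
  ordered (tri< x<y _ _) = mean x y (<⇒<ᵇ x<y)
  ordered (tri≈ _ x≡y _) = contradiction (toℕ-injective x≡y) x≢y
  ordered (tri> _ _ y<x) =
    subst (λ z → FloorOrCeil z (sumOver _<ᶠ_ f) (sumOver {n} _<ᶠ_ (λ _ _ → 1))) (f-sym y x) (mean y x (<⇒<ᵇ y<x))

nearTripleArray : ∀ {r c v} (A : Design r c v) → Binary A → ∀ {a b d e} →
                  (∀ s → InBand a (rep A s)) →
                  (∀ i j → InBand b (rowCol A i j)) →
                  (∀ i i' → i ≢ i' → InBand d (rowRow A i i')) →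
                  (∀ j j' → j ≢ j' → InBand e (colCol A j j')) →
                  NearTripleArray r c v A
nearTripleArray {r} {c} {v} A bin {a} {b} repBand rcBand rrBand ccBand =
  bin , repMean , rcMean ,
  floorOrCeil-pairs r (rowRow A) _ (rowRow-sym A) rrBand ,
  floorOrCeil-pairs c (colCol A) _ (colCol-sym A) ccBand
  where
  count : ∀ m n → sumOver {m} {n} (λ _ _ → true) (λ _ _ → 1) ≡ m * n
  count m n = trans (sumF-cong m (λ _ → trans (sumF-const n 1) (*-identityʳ n))) (sumF-const m n)
  -- The replications are summed as the single row of a 1 × v array.
  repMean : ∀ s → FloorOrCeil (rep A s) (r * c) v
  repMean s = subst₂ (FloorOrCeil (rep A s)) (trans (+-identityʳ _) (sumF-rep A)) (trans (count 1 v) (+-identityʳ v))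
    (floorOrCeil-band {1} (λ _ _ → true) (λ _ → rep A) a (λ _ s _ → repBand s) Fin.zero s tt)
  rcMean : ∀ i j → FloorOrCeil (rowCol A i j) (sumRC A) (r * c)
  rcMean i j = subst (FloorOrCeil (rowCol A i j) (sumRC A)) (count r c)
    (floorOrCeil-band (λ _ _ → true) (rowCol A) b (λ i j _ → rcBand i j) i j tt)

-- Base-3 digits and residues mod k

3a+b≡b+a*3 : ∀ a b → 3 * a + b ≡ b + a * 3
3a+b≡b+a*3 a b = trans (+-comm (3 * a) b) (cong (b +_) (*-comm 3 a))

[3a+b]%3≡b : ∀ a {b} → b < 3 → (3 * a + b) % 3 ≡ b
[3a+b]%3≡b a {b} b<3 = trans (cong (_% 3) (3a+b≡b+a*3 a b)) (trans ([m+kn]%n≡m%n b a 3) (m<n⇒m%n≡m b<3))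

[3a+b]/3≡a : ∀ a {b} → b < 3 → (3 * a + b) / 3 ≡ a
[3a+b]/3≡a a {b} b<3 = begin
  (3 * a + b) / 3   ≡⟨ cong (_/ 3) (3a+b≡b+a*3 a b) ⟩
  (b + a * 3) / 3   ≡⟨ +-distrib-/-∣ʳ b (divides-refl a) ⟩
  b / 3 + a * 3 / 3 ≡⟨ cong₂ _+_ (m<n⇒m/n≡0 b<3) (m*n/n≡m a 3) ⟩
  a                 ∎
  where open ≡-Reasoning

3a+b-injective : ∀ a a' {b b'} → b < 3 → b' < 3 → 3 * a + b ≡ 3 * a' + b' → a ≡ a' × b ≡ b'
3a+b-injective a a' b<3 b'<3 eq =
    trans (sym ([3a+b]/3≡a a b<3)) (trans (cong (_/ 3) eq) ([3a+b]/3≡a a' b'<3))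
  , trans (sym ([3a+b]%3≡b a b<3)) (trans (cong (_% 3) eq) ([3a+b]%3≡b a' b'<3))

3a+b<3k : ∀ {a b k} → a < k → b < 3 → 3 * a + b < 3 * k
3a+b<3k {a} {b} {k} a<k b<3 = begin-strict
  3 * a + b   <⟨ +-monoʳ-< (3 * a) b<3 ⟩
  3 * a + 3   ≡⟨ trans (+-comm (3 * a) 3) (sym (*-suc 3 a)) ⟩
  3 * suc a   ≤⟨ *-monoʳ-≤ 3 a<k ⟩
  3 * k       ∎
  where open ≤-Reasoning

3a+b<3k⇒a<k : ∀ {a b k} → 3 * a + b < 3 * k → a < k
3a+b<3k⇒a<k {a} {b} {k} lt = *-cancelˡ-< 3 a k (≤-<-trans (m≤m+n (3 * a) b) lt)

3[m/3]+m%3≡m : ∀ m → 3 * (m / 3) + m % 3 ≡ m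
3[m/3]+m%3≡m m = sym (trans (m≡m%n+[m/n]*n m 3) (trans (+-comm (m % 3) _) (cong (_+ m % 3) (*-comm (m / 3) 3))))

module Modulo (k : ℕ) .{{_ : NonZero k}} where

  [x+y]%k+z≡x : ∀ {x} y z → x < k → y + z ≡ k → ((x + y) % k + z) % k ≡ x
  [x+y]%k+z≡x {x} y z x<k y+z≡k = begin
    ((x + y) % k + z) % k           ≡⟨ %-distribˡ-+ ((x + y) % k) z k ⟩
    ((x + y) % k % k + z % k) % k   ≡⟨ cong (λ w → (w + z % k) % k) (m%n%n≡m%n (x + y) k) ⟩
    ((x + y) % k + z % k) % k       ≡⟨ %-distribˡ-+ (x + y) z k ⟨
    (x + y + z) % k                 ≡⟨ cong (_% k) (trans (+-assoc x y z) (cong (x +_) y+z≡k)) ⟩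
    (x + k) % k                     ≡⟨ [m+n]%n≡m%n x k ⟩
    x % k                           ≡⟨ m<n⇒m%n≡m x<k ⟩
    x                               ∎
    where open ≡-Reasoning

  -- Adding k ∸ x % k undoes the shift by x.
  +-%-cancelˡ : ∀ x {b b'} → b < k → b' < k → (x + b) % k ≡ (x + b') % k → b ≡ b'
  +-%-cancelˡ x {b} {b'} b<k b'<k eq = begin
    b                                   ≡⟨ undo b<k ⟨
    ((b + x % k) % k + (k ∸ x % k)) % k ≡⟨ cong (λ w → (w + (k ∸ x % k)) % k) (trans (shift b) (trans eq (sym (shift b')))) ⟩
    ((b' + x % k) % k + (k ∸ x % k)) % k ≡⟨ undo b'<k ⟩
    b'                                  ∎
    where
    open ≡-Reasoning
    undo : ∀ {c} → c < k → ((c + x % k) % k + (k ∸ x % k)) % k ≡ c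
    undo c<k = [x+y]%k+z≡x (x % k) (k ∸ x % k) c<k (m+[n∸m]≡n (<⇒≤ (m%n<n x k)))
    shift : ∀ c → (c + x % k) % k ≡ (x + c) % k
    shift c = begin
      (c + x % k) % k          ≡⟨ %-distribˡ-+ c (x % k) k ⟩
      (c % k + x % k % k) % k  ≡⟨ cong (λ w → (c % k + w) % k) (m%n%n≡m%n x k) ⟩
      (c % k + x % k) % k      ≡⟨ %-distribˡ-+ c x k ⟨
      (c + x) % k              ≡⟨ cong (_% k) (+-comm c x) ⟩
      (x + c) % k              ∎

-- The array T

prev : Fin 3 → ℕ
prev 0F = 2
prev 1F = 0
prev 2F = 1

prev<3 : ∀ i → prev i < 3
prev<3 0F = s≤s (s≤s (s≤s z≤n))
prev<3 1F = s≤s z≤n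
prev<3 2F = s≤s (s≤s z≤n)

prev-injective : ∀ i i' → prev i ≡ prev i' → i ≡ i'
prev-injective 0F 0F _ = refl
prev-injective 1F 1F _ = refl
prev-injective 2F 2F _ = refl
prev-injective 0F 1F ()
prev-injective 0F 2F ()
prev-injective 1F 0F ()
prev-injective 1F 2F ()
prev-injective 2F 0F ()
prev-injective 2F 1F ()

prev≢toℕ : ∀ i → prev i ≢ toℕ i
prev≢toℕ 0F ()
prev≢toℕ 1F ()
prev≢toℕ 2F ()

[prev+1]%3≡toℕ : ∀ i → (prev i + 1) % 3 ≡ toℕ i
[prev+1]%3≡toℕ 0F = refl
[prev+1]%3≡toℕ 1F = refl
[prev+1]%3≡toℕ 2F = refl

prev-of-succ : ∀ i {b} → b < 3 → toℕ i ≡ (b + 1) % 3 → prev i ≡ b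
prev-of-succ 0F {2} _ _ = refl
prev-of-succ 1F {0} _ _ = refl
prev-of-succ 2F {1} _ _ = refl
prev-of-succ i {suc (suc (suc _))} (s≤s (s≤s (s≤s ()))) _

-- Row i of T holds the symbols 3a + b with b = i (left half) or b = i - 1 mod 3 (right half).
holds : Fin 3 → ℕ → Bool
holds 0F 0 = true
holds 0F 2 = true
holds 1F 0 = true
holds 1F 1 = true
holds 2F 1 = true
holds 2F 2 = true
holds _ _ = false

holds-toℕ : ∀ i → holds i (toℕ i) ≡ true
holds-toℕ 0F = refl
holds-toℕ 1F = refl
holds-toℕ 2F = refl

holds-prev : ∀ i → holds i (prev i) ≡ true
holds-prev 0F = refl
holds-prev 1F = refl
holds-prev 2F = refl

holds⇒ : ∀ i b → holds i b ≡ true → b ≡ toℕ i ⊎ b ≡ prev i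
holds⇒ 0F 0 _ = inj₁ refl
holds⇒ 0F 2 _ = inj₂ refl
holds⇒ 1F 0 _ = inj₂ refl
holds⇒ 1F 1 _ = inj₁ refl
holds⇒ 2F 1 _ = inj₂ refl
holds⇒ 2F 2 _ = inj₁ refl

is-corner : ∀ (i : Fin 3) {n} → ((toℕ i ≡ᵇ 0) ∧ (n ≡ᵇ 0)) ≡ true → i ≡ 0F × n ≡ 0
is-corner 0F {zero} _ = refl , refl
is-corner 1F ()
is-corner 2F ()

module DesignT (k : ℕ) .{{_ : NonZero k}} (3≤k : 3 ≤ k) where
  open Modulo k

  0<k : 0 < k
  0<k = ≤-trans (s≤s z≤n) 3≤k

  prev<k : ∀ i → prev i < k
  prev<k i = <-≤-trans (prev<3 i) 3≤k

  -- Cell (i, k + c) of T holds 3a + prev i where a + prev i ≡ c (mod k), that is, a = block i c.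
  block : Fin 3 → ℕ → ℕ
  block i c = (c + (k ∸ prev i)) % k

  block<k : ∀ i c → block i c < k
  block<k i c = m%n<n _ k

  [block+prev]%k≡ : ∀ i {c} → c < k → (block i c + prev i) % k ≡ c
  [block+prev]%k≡ i c<k = [x+y]%k+z≡x (k ∸ prev i) (prev i) c<k (m∸n+n≡m (<⇒≤ (prev<k i)))

  block-of : ∀ i {a} → a < k → block i ((a + prev i) % k) ≡ a
  block-of i a<k = [x+y]%k+z≡x (prev i) (k ∸ prev i) a<k (m+[n∸m]≡n (<⇒≤ (prev<k i)))

  data Half (j : Fin (2 * k)) : Set where
    left  : toℕ j < k → Half j
    right : ∀ c → c < k → toℕ j ≡ k + c → Half j

  half : ∀ j → Half j
  half j with toℕ j <? k
  ... | yes j<k = left j<k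
  ... | no j≮k = right (toℕ j ∸ k) j∸k<k (sym (m+[n∸m]≡n (≮⇒≥ j≮k)))
    where
    j∸k<k : toℕ j ∸ k < k
    j∸k<k = subst (toℕ j ∸ k <_) (trans (m+n∸m≡n k (k + 0)) (+-identityʳ k)) (∸-monoˡ-< (toℕ<n j) (≮⇒≥ j≮k))

  leftCol : ∀ {a} → a < k → Fin (2 * k)
  leftCol a<k = fromℕ< (<-≤-trans a<k (m≤m+n k (k + 0)))

  rightCol : ∀ {c} → c < k → Fin (2 * k)
  rightCol c<k = fromℕ< (+-monoʳ-< k (<-≤-trans c<k (m≤m+n k 0)))

  blockOf resOf : Fin 3 → ∀ {j} → Half j → ℕ
  blockOf i {j} (left _) = toℕ j
  blockOf i (right c _ _) = block i c
  resOf i (left _) = toℕ i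
  resOf i (right _ _ _) = prev i

  resOf<3 : ∀ i {j} (h : Half j) → resOf i h < 3
  resOf<3 i (left _) = toℕ<n i
  resOf<3 i (right _ _ _) = prev<3 i

  blockOf<k : ∀ i {j} (h : Half j) → blockOf i h < k
  blockOf<k i (left j<k) = j<k
  blockOf<k i (right c _ _) = block<k i c

  T₀ : Design 3 (2 * k) (3 * k)
  T₀ i j = fromℕ< (3a+b<3k (blockOf<k i (half j)) (resOf<3 i (half j)))

  isT₀ : IsT k T₀
  isT₀ a b a<k b<3 = onLeft , onRight
    where
    onLeft : ∀ i j → toℕ i ≡ b → toℕ j ≡ a → toℕ (T₀ i j) ≡ 3 * a + b
    onLeft i j i≡b j≡a = trans (toℕ-fromℕ< _) (digits (half j))
      where
      digits : (h : Half j) → 3 * blockOf i h + resOf i h ≡ 3 * a + b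
      digits (left _) = cong₂ (λ x y → 3 * x + y) j≡a i≡b
      digits (right c _ j≡k+c) = contradiction (subst (_< k) (trans (sym j≡a) j≡k+c) a<k) (m+n≮m k c)
    onRight : ∀ i j → toℕ i ≡ (b + 1) % 3 → toℕ j ≡ k + ((a + b) % k) → toℕ (T₀ i j) ≡ 3 * a + b
    onRight i j i≡b+1 j≡ = trans (toℕ-fromℕ< _) (digits (half j))
      where
      prev≡b : prev i ≡ b
      prev≡b = prev-of-succ i b<3 i≡b+1
      digits : (h : Half j) → 3 * blockOf i h + resOf i h ≡ 3 * a + b
      digits (left j<k) = contradiction (subst (_< k) j≡ j<k) (m+n≮m k _)
      digits (right c _ j≡k+c) = cong₂ (λ x y → 3 * x + y) block≡a prev≡b
        where
        block≡a : block i c ≡ a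
        block≡a = trans (cong (block i) (+-cancelˡ-≡ k c _ (trans (sym j≡k+c) j≡)))
                    (trans (cong (λ z → block i ((a + z) % k)) (sym prev≡b)) (block-of i a<k))

  sumF-halves : ∀ (f : Fin (2 * k) → ℕ) {L R} → (∀ j → toℕ j < k → f j ≡ L) →
                (∀ j c → c < k → toℕ j ≡ k + c → f j ≡ R) → sumF (2 * k) f ≡ k * L + k * R
  sumF-halves f {L} {R} onLeft onRight = begin
      sumF (k + (k + 0)) f
    ≡⟨ sumF-↑ k (k + 0) f ⟩
      sumF k (λ x → f (x ↑ˡ (k + 0))) + sumF (k + 0) (λ y → f (k ↑ʳ y))
    ≡⟨ cong (sumF k (λ x → f (x ↑ˡ (k + 0))) +_) (trans (sumF-↑ k 0 (λ y → f (k ↑ʳ y))) (+-identityʳ _)) ⟩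
      sumF k (λ x → f (x ↑ˡ (k + 0))) + sumF k (λ y → f (k ↑ʳ (y ↑ˡ 0)))
    ≡⟨ cong₂ _+_ (sumF-cong k (λ x → onLeft _ (subst (_< k) (sym (toℕ-↑ˡ x (k + 0))) (toℕ<n x))))
                 (sumF-cong k (λ y → onRight _ (toℕ y) (toℕ<n y) (trans (toℕ-↑ʳ k (y ↑ˡ 0)) (cong (k +_) (toℕ-↑ˡ y 0))))) ⟩
      sumF k (λ _ → L) + sumF k (λ _ → R)
    ≡⟨ cong₂ _+_ (sumF-const k L) (sumF-const k R) ⟩
      k * L + k * R
    ∎
    where open ≡-Reasoning

  module _ (T : Design 3 (2 * k) (3 * k)) (isT : IsT k T) where

    cell-left : ∀ i j → toℕ j < k → toℕ (T i j) ≡ 3 * toℕ j + toℕ i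
    cell-left i j j<k = proj₁ (isT (toℕ j) (toℕ i) j<k (toℕ<n i)) i j refl refl

    cell-right : ∀ i j c → c < k → toℕ j ≡ k + c → toℕ (T i j) ≡ 3 * block i c + prev i
    cell-right i j c c<k j≡k+c = proj₂ (isT (block i c) (prev i) (block<k i c) (prev<3 i)) i j
      (sym ([prev+1]%3≡toℕ i)) (trans j≡k+c (cong (k +_) (sym ([block+prev]%k≡ i c<k))))

    cell : ∀ i {j} (h : Half j) → toℕ (T i j) ≡ 3 * blockOf i h + resOf i h
    cell i {j} (left j<k) = cell-left i j j<k
    cell i {j} (right c c<k j≡k+c) = cell-right i j c c<k j≡k+c

    digits-≡ : ∀ {i j i' j'} (h : Half j) (h' : Half j') → T i j ≡ T i' j' →
               blockOf i h ≡ blockOf i' h' × resOf i h ≡ resOf i' h'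
    digits-≡ {i} {i' = i'} h h' eq =
      3a+b-injective (blockOf i h) (blockOf i' h') (resOf<3 i h) (resOf<3 i' h')
        (trans (sym (cell i h)) (trans (cong toℕ eq) (cell i' h')))

    digits-of : ∀ {i j} s (h : Half j) → T i j ≡ s → toℕ s ≡ 3 * blockOf i h + resOf i h
    digits-of {i} s h eq = trans (cong toℕ (sym eq)) (cell i h)

    holds-resOf : ∀ i {j} (h : Half j) → holds i (resOf i h) ≡ true
    holds-resOf i (left _) = holds-toℕ i
    holds-resOf i (right _ _ _) = holds-prev i

    inRow-T : ∀ i s a {b} → toℕ s ≡ 3 * a + b → b < 3 → inRow T i s ≡ holds i b
    inRow-T i s a {b} s≡3a+b b<3 = ≡-from-true to from
      where
      a<k : a < k
      a<k = 3a+b<3k⇒a<k (subst (_< 3 * k) s≡3a+b (toℕ<n s))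
      to : inRow T i s ≡ true → holds i b ≡ true
      to h with inRow-elim T i s h
      ... | j , Tij≡s = subst (λ z → holds i z ≡ true) (sym b≡res) (holds-resOf i (half j))
        where
        b≡res : b ≡ resOf i (half j)
        b≡res = proj₂ (3a+b-injective a (blockOf i (half j)) b<3 (resOf<3 i (half j))
                         (trans (sym s≡3a+b) (digits-of s (half j) Tij≡s)))
      from : holds i b ≡ true → inRow T i s ≡ true
      from h with holds⇒ i b h
      ... | inj₁ b≡i = inRow-intro T i (leftCol a<k) s (toℕ-injective
            (trans (proj₁ (isT a b a<k b<3) i _ (sym b≡i) (toℕ-fromℕ< _)) (sym s≡3a+b)))
      ... | inj₂ b≡prev = inRow-intro T i (rightCol (m%n<n (a + b) k)) s (toℕ-injective
            (trans (proj₂ (isT a b a<k b<3) i _ i≡b+1 (toℕ-fromℕ< _)) (sym s≡3a+b)))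
        where
        i≡b+1 : toℕ i ≡ (b + 1) % 3
        i≡b+1 = trans (sym ([prev+1]%3≡toℕ i)) (cong (λ z → (z + 1) % 3) (sym b≡prev))

    row-injective : ∀ i → Injective _≡_ _≡_ (T i)
    row-injective i {j} {j'} eq with half j | half j'
    ... | left j<k | left j'<k = toℕ-injective (proj₁ (digits-≡ (left j<k) (left j'<k) eq))
    ... | left j<k | right c' c'<k j'≡ =
      contradiction (sym (proj₂ (digits-≡ (left j<k) (right c' c'<k j'≡) eq))) (prev≢toℕ i)
    ... | right c c<k j≡ | left j'<k =
      contradiction (proj₂ (digits-≡ (right c c<k j≡) (left j'<k) eq)) (prev≢toℕ i)
    ... | right c c<k j≡ | right c' c'<k j'≡ = toℕ-injective (trans j≡ (trans (cong (k +_) c≡c') (sym j'≡)))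
      where
      c≡c' : c ≡ c'
      c≡c' = trans (sym ([block+prev]%k≡ i c<k))
        (trans (cong (λ z → (z + prev i) % k) (proj₁ (digits-≡ (right c c<k j≡) (right c' c'<k j'≡) eq)))
          ([block+prev]%k≡ i c'<k))

    col-injective : ∀ j → Injective _≡_ _≡_ (λ i → T i j)
    col-injective j {i} {i'} eq with half j
    ... | left j<k = toℕ-injective (proj₂ (digits-≡ (left j<k) (left j<k) eq))
    ... | right c c<k j≡ = prev-injective i i' (proj₂ (digits-≡ (right c c<k j≡) (right c c<k j≡) eq))

    binary-T : Binary T
    binary-T = binary T row-injective col-injective

    rep-T : ∀ s → rep T s ≡ 2
    rep-T s = begin
      rep T s                                 ≡⟨ rep-rows T row-injective s ⟩
      sumF 3 (λ i → 𝟙 (inRow T i s))          ≡⟨ sumF-cong 3 (λ i → cong 𝟙 (inRow-T i s (toℕ s / 3) (sym (3[m/3]+m%3≡m (toℕ s))) b<3)) ⟩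
      sumF 3 (λ i → 𝟙 (holds i (toℕ s % 3))) ≡⟨ holders (toℕ s % 3) b<3 ⟩
      2                                       ∎
      where
      open ≡-Reasoning
      b<3 : toℕ s % 3 < 3
      b<3 = m%n<n (toℕ s) 3
      holders : ∀ b → b < 3 → sumF 3 (λ i → 𝟙 (holds i b)) ≡ 2
      holders 0 _ = refl
      holders 1 _ = refl
      holders 2 _ = refl
      holders (suc (suc (suc _))) (s≤s (s≤s (s≤s ())))

    inRow-cell : ∀ i i' {j} (h : Half j) → inRow T i (T i' j) ≡ holds i (resOf i' h)
    inRow-cell i i' h = inRow-T i _ (blockOf i' h) (cell i' h) (resOf<3 i' h)

    rowCol-T : ∀ i j → rowCol T i j ≡ 2
    rowCol-T i j = trans (rowCol-cells T i j (col-injective j))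
      (trans (sumF-cong 3 (λ i' → cong 𝟙 (inRow-cell i i' (half j)))) (column-residues i (half j)))
      where
      column-residues : ∀ i {j} (h : Half j) → sumF 3 (λ i' → 𝟙 (holds i (resOf i' h))) ≡ 2
      column-residues 0F (left _) = refl
      column-residues 1F (left _) = refl
      column-residues 2F (left _) = refl
      column-residues 0F (right _ _ _) = refl
      column-residues 1F (right _ _ _) = refl
      column-residues 2F (right _ _ _) = refl

    rowRow-T : ∀ i i' → i ≢ i' → rowRow T i i' ≡ k
    rowRow-T i i' i≢i' = begin
        rowRow T i i'
      ≡⟨ rowRow-cells T i i' (row-injective i') ⟩
        sumF (2 * k) (λ j → 𝟙 (inRow T i (T i' j)))
      ≡⟨ sumF-halves _ (λ j j<k → cong 𝟙 (inRow-cell i i' (left j<k)))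
                       (λ j c c<k j≡ → cong 𝟙 (inRow-cell i i' (right c c<k j≡))) ⟩
        k * 𝟙 (holds i (toℕ i')) + k * 𝟙 (holds i (prev i'))
      ≡⟨ *-distribˡ-+ k _ _ ⟨
        k * (𝟙 (holds i (toℕ i')) + 𝟙 (holds i (prev i')))
      ≡⟨ cong (k *_) (other-row i i' i≢i') ⟩
        k * 1
      ≡⟨ *-identityʳ k ⟩
        k
      ∎
      where
      open ≡-Reasoning
      other-row : ∀ i i' → i ≢ i' → 𝟙 (holds i (toℕ i')) + 𝟙 (holds i (prev i')) ≡ 1
      other-row 0F 0F ne = contradiction refl ne
      other-row 1F 1F ne = contradiction refl ne
      other-row 2F 2F ne = contradiction refl ne
      other-row 0F 1F _ = refl
      other-row 0F 2F _ = refl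
      other-row 1F 0F _ = refl
      other-row 1F 2F _ = refl
      other-row 2F 0F _ = refl
      other-row 2F 1F _ = refl

    -- At most one cell of column j' lies in column j: between a left and a right column the
    -- rows of two such cells would differ by a shift of size < 3 ≤ k that vanishes mod k.
    colCol-T≤1 : ∀ j j' → j ≢ j' → colCol T j j' ≤ 1
    colCol-T≤1 j j' j≢j' =
      subst (_≤ 1) (sym (trans (colCol-cells T j j' (col-injective j')) (countF-≤1 3 _ unique))) (𝟙≤1 _)
      where
      unique : ∀ i₁ i₂ → inCol T j (T i₁ j') ≡ true → inCol T j (T i₂ j') ≡ true → i₁ ≡ i₂
      unique i₁ i₂ in₁ in₂ with inCol-elim T j _ in₁ | inCol-elim T j _ in₂ | half j | half j'
      ... | _ , e₁ | _ , _ | left j<k | left j'<k =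
        contradiction (toℕ-injective (proj₁ (digits-≡ (left j<k) (left j'<k) e₁))) j≢j'
      ... | m₁ , e₁ | _ , _ | right c c<k j≡ | right c' c'<k j'≡ =
        contradiction (toℕ-injective (trans j≡ (trans (cong (k +_) c≡c') (sym j'≡)))) j≢j'
        where
        c≡c' : c ≡ c'
        c≡c' with digits-≡ (right c c<k j≡) (right c' c'<k j'≡) e₁
        ... | b≡b' , r≡r' = trans (sym ([block+prev]%k≡ m₁ c<k))
                              (trans (cong₂ (λ x y → (x + y) % k) b≡b' r≡r') ([block+prev]%k≡ i₁ c'<k))
      ... | _ , e₁ | _ , e₂ | left j<k | right c' c'<k j'≡ =
        prev-injective i₁ i₂ (+-%-cancelˡ (toℕ j) (prev<k i₁) (prev<k i₂) (trans (shifted i₁ e₁) (sym (shifted i₂ e₂))))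
        where
        shifted : ∀ {m} i → T m j ≡ T i j' → (toℕ j + prev i) % k ≡ c'
        shifted i e = trans (cong (λ x → (x + prev i) % k) (proj₁ (digits-≡ (left j<k) (right c' c'<k j'≡) e)))
                            ([block+prev]%k≡ i c'<k)
      ... | _ , e₁ | _ , e₂ | right c c<k j≡ | left j'<k =
        toℕ-injective (+-%-cancelˡ (toℕ j') (row<k i₁) (row<k i₂) (trans (shifted e₁) (sym (shifted e₂))))
        where
        row<k : ∀ i → toℕ i < k
        row<k i = <-≤-trans (toℕ<n i) 3≤k
        shifted : ∀ {m i} → T m j ≡ T i j' → (toℕ j' + toℕ i) % k ≡ c
        shifted {m} e with digits-≡ (right c c<k j≡) (left j'<k) e
        ... | b≡j' , prev≡i = trans (cong₂ (λ x y → (x + y) % k) (sym b≡j') (sym prev≡i)) ([block+prev]%k≡ m c<k)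

    nearTripleArray-T : NearTripleArray 3 (2 * k) (3 * k) T
    nearTripleArray-T = nearTripleArray T binary-T
      (λ s → ≡⇒InBand (rep-T s))
      (λ i j → ≡⇒InBand (rowCol-T i j))
      (λ i i' i≢i' → ≡⇒InBand (rowRow-T i i' i≢i'))
      (λ j j' j≢j' → z≤n , colCol-T≤1 j j' j≢j')

    -- The array T'

    T⁺ : Design 3 (2 * k + 1) (3 * k + 2)
    T⁺ = T' k T

    col₀ : Fin (2 * k)
    col₀ = leftCol 0<k

    toℕ-col₀ : toℕ col₀ ≡ 0
    toℕ-col₀ = toℕ-fromℕ< _

    col₀<k : toℕ col₀ < k
    col₀<k = subst (_< k) (sym toℕ-col₀) 0<k

    T₀₀≡0 : toℕ (T 0F col₀) ≡ 0
    T₀₀≡0 = trans (cell-left 0F col₀ col₀<k) (cong (λ a → 3 * a + 0) toℕ-col₀)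

    last⁺ : Fin (2 * k + 1)
    last⁺ = 2 * k ↑ʳ 0F

    new₀ new₁ : Fin (3 * k + 2)
    new₀ = 3 * k ↑ʳ 0F
    new₁ = 3 * k ↑ʳ 1F

    firstEntry lastEntry : Fin 3 → Fin (3 * k + 2)
    firstEntry 0F = new₀
    firstEntry i = T i col₀ ↑ˡ 2
    lastEntry 0F = T 0F col₀ ↑ˡ 2
    lastEntry 1F = new₀
    lastEntry 2F = new₁

    cell⁺-kept : ∀ i j₀ → ¬ (i ≡ 0F × toℕ j₀ ≡ 0) → T⁺ i (j₀ ↑ˡ 1) ≡ T i j₀ ↑ˡ 2
    cell⁺-kept i j₀ not-corner with toℕ (j₀ ↑ˡ 1) <? 2 * k
    ... | no j≮2k = contradiction (subst (_< 2 * k) (sym (toℕ-↑ˡ j₀ 1)) (toℕ<n j₀)) j≮2k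
    ... | yes j<2k with (toℕ i ≡ᵇ 0) ∧ (toℕ (j₀ ↑ˡ 1) ≡ᵇ 0) in corner
    ...   | false = cong (λ j → T i j ↑ˡ 2) (toℕ-injective (trans (toℕ-fromℕ< j<2k) (toℕ-↑ˡ j₀ 1)))
    ...   | true with is-corner i corner
    ...     | i≡0 , j≡0 = contradiction (i≡0 , trans (sym (toℕ-↑ˡ j₀ 1)) j≡0) not-corner

    cell⁺-corner : ∀ j₀ → toℕ j₀ ≡ 0 → T⁺ 0F (j₀ ↑ˡ 1) ≡ new₀
    cell⁺-corner j₀ j₀≡0 with toℕ (j₀ ↑ˡ 1) <? 2 * k
    ... | no j≮2k = contradiction (subst (_< 2 * k) (sym (toℕ-↑ˡ j₀ 1)) (toℕ<n j₀)) j≮2k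
    ... | yes j<2k with toℕ (j₀ ↑ˡ 1) ≡ᵇ 0 in corner
    ...   | true = toℕ-injective (trans (toℕ-fromℕ< _) (sym (trans (toℕ-↑ʳ (3 * k) 0F) (+-identityʳ _))))
    ...   | false = contradiction (trans (sym corner) (cong (_≡ᵇ 0) (trans (toℕ-↑ˡ j₀ 1) j₀≡0))) λ ()

    cell⁺-last : ∀ i → T⁺ i last⁺ ≡ lastEntry i
    cell⁺-last i with toℕ last⁺ <? 2 * k
    ... | yes last<2k = contradiction (subst (_< 2 * k) (trans (toℕ-↑ʳ (2 * k) 0F) (+-identityʳ _)) last<2k) (n≮n _)
    cell⁺-last 0F | no _ = toℕ-injective (trans (toℕ-fromℕ< _) (sym (trans (toℕ-↑ˡ (T 0F col₀) 2) T₀₀≡0)))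
    cell⁺-last 1F | no _ = toℕ-injective (trans (toℕ-fromℕ< _) (sym (trans (toℕ-↑ʳ (3 * k) 0F) (+-identityʳ _))))
    cell⁺-last 2F | no _ = toℕ-injective (trans (toℕ-fromℕ< _) (sym (toℕ-↑ʳ (3 * k) 1F)))

    cell⁺-first : ∀ i → T⁺ i (col₀ ↑ˡ 1) ≡ firstEntry i
    cell⁺-first 0F = cell⁺-corner col₀ toℕ-col₀
    cell⁺-first 1F = cell⁺-kept 1F col₀ λ { (() , _) }
    cell⁺-first 2F = cell⁺-kept 2F col₀ λ { (() , _) }

    cell⁺-middle : ∀ i j₀ → toℕ j₀ ≢ 0 → T⁺ i (j₀ ↑ˡ 1) ≡ T i j₀ ↑ˡ 2
    cell⁺-middle i j₀ j₀≢0 = cell⁺-kept i j₀ (j₀≢0 ∘ proj₂)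

    data Column⁺ : Fin (2 * k + 1) → Set where
      first  : Column⁺ (col₀ ↑ˡ 1)
      middle : ∀ j₀ → toℕ j₀ ≢ 0 → Column⁺ (j₀ ↑ˡ 1)
      last   : Column⁺ last⁺

    column⁺ : ∀ j → Column⁺ j
    column⁺ j with ↑-view (2 * k) 1 j
    ... | ↑ʳ-view 0F = last
    ... | ↑ˡ-view j₀ with toℕ j₀ ≟ℕ 0
    ...   | yes j₀≡0 = subst (λ x → Column⁺ (x ↑ˡ 1)) (toℕ-injective (trans toℕ-col₀ (sym j₀≡0))) first
    ...   | no j₀≢0 = middle j₀ j₀≢0

    old-source : ∀ i {j} → Column⁺ j → ∀ {s₀} → T⁺ i j ≡ s₀ ↑ˡ 2 → Σ (Fin (2 * k)) (λ j₀ → T i j₀ ≡ s₀)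
    old-source 0F first e = contradiction (trans (sym (cell⁺-first 0F)) e) (↑ʳ≢↑ˡ _ _)
    old-source 1F first e = col₀ , ↑ˡ-injective 2 _ _ (trans (sym (cell⁺-first 1F)) e)
    old-source 2F first e = col₀ , ↑ˡ-injective 2 _ _ (trans (sym (cell⁺-first 2F)) e)
    old-source i (middle j₀ j₀≢0) e = j₀ , ↑ˡ-injective 2 _ _ (trans (sym (cell⁺-middle i j₀ j₀≢0)) e)
    old-source 0F last e = col₀ , ↑ˡ-injective 2 _ _ (trans (sym (cell⁺-last 0F)) e)
    old-source 1F last e = contradiction (trans (sym (cell⁺-last 1F)) e) (↑ʳ≢↑ˡ _ _)
    old-source 2F last e = contradiction (trans (sym (cell⁺-last 2F)) e) (↑ʳ≢↑ˡ _ _)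

    old-target : ∀ i j₀ → Σ (Fin (2 * k + 1)) (λ j → T⁺ i j ≡ T i j₀ ↑ˡ 2)
    old-target 0F j₀ with toℕ j₀ ≟ℕ 0
    ... | yes j₀≡0 = last⁺ , trans (cell⁺-last 0F) (cong (λ x → T 0F x ↑ˡ 2) (toℕ-injective (trans toℕ-col₀ (sym j₀≡0))))
    ... | no j₀≢0 = j₀ ↑ˡ 1 , cell⁺-middle 0F j₀ j₀≢0
    old-target 1F j₀ = j₀ ↑ˡ 1 , cell⁺-kept 1F j₀ λ { (() , _) }
    old-target 2F j₀ = j₀ ↑ˡ 1 , cell⁺-kept 2F j₀ λ { (() , _) }

    -- Rows 0 and 1 of T⁺ gain the symbol 3k, row 2 gains 3k + 1.
    holdsNew : Fin 3 → Fin 2 → Bool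
    holdsNew 0F 0F = true
    holdsNew 1F 0F = true
    holdsNew 2F 1F = true
    holdsNew _ _ = false

    new-source : ∀ i {j} → Column⁺ j → ∀ t → T⁺ i j ≡ 3 * k ↑ʳ t → holdsNew i t ≡ true
    new-source 0F first 0F _ = refl
    new-source 0F first 1F e = contradiction (↑ʳ-injective (3 * k) _ _ (trans (sym (cell⁺-first 0F)) e)) λ ()
    new-source 1F first t e = contradiction (trans (sym (cell⁺-first 1F)) e) (↑ˡ≢↑ʳ _ _)
    new-source 2F first t e = contradiction (trans (sym (cell⁺-first 2F)) e) (↑ˡ≢↑ʳ _ _)
    new-source i (middle j₀ j₀≢0) t e = contradiction (trans (sym (cell⁺-middle i j₀ j₀≢0)) e) (↑ˡ≢↑ʳ _ _)
    new-source 0F last t e = contradiction (trans (sym (cell⁺-last 0F)) e) (↑ˡ≢↑ʳ _ _)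
    new-source 1F last 0F _ = refl
    new-source 1F last 1F e = contradiction (↑ʳ-injective (3 * k) _ _ (trans (sym (cell⁺-last 1F)) e)) λ ()
    new-source 2F last 0F e = contradiction (↑ʳ-injective (3 * k) _ _ (trans (sym (cell⁺-last 2F)) e)) λ ()
    new-source 2F last 1F _ = refl

    inRow⁺-old : ∀ i s₀ → inRow T⁺ i (s₀ ↑ˡ 2) ≡ inRow T i s₀
    inRow⁺-old i s₀ = ≡-from-true to from
      where
      to : inRow T⁺ i (s₀ ↑ˡ 2) ≡ true → inRow T i s₀ ≡ true
      to h with inRow-elim T⁺ i _ h
      ... | j , e with old-source i (column⁺ j) e
      ...   | j₀ , e₀ = inRow-intro T i j₀ s₀ e₀
      from : inRow T i s₀ ≡ true → inRow T⁺ i (s₀ ↑ˡ 2) ≡ true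
      from h with inRow-elim T i s₀ h
      ... | j₀ , e₀ with old-target i j₀
      ...   | j , e = inRow-intro T⁺ i j _ (trans e (cong (_↑ˡ 2) e₀))

    inRow⁺-new : ∀ i t → inRow T⁺ i (3 * k ↑ʳ t) ≡ holdsNew i t
    inRow⁺-new i t = ≡-from-true to (from i t)
      where
      to : inRow T⁺ i (3 * k ↑ʳ t) ≡ true → holdsNew i t ≡ true
      to h with inRow-elim T⁺ i _ h
      ... | j , e = new-source i (column⁺ j) t e
      from : ∀ i t → holdsNew i t ≡ true → inRow T⁺ i (3 * k ↑ʳ t) ≡ true
      from 0F 0F _ = inRow-intro T⁺ 0F _ _ (cell⁺-first 0F)
      from 1F 0F _ = inRow-intro T⁺ 1F _ _ (cell⁺-last 1F)
      from 2F 1F _ = inRow-intro T⁺ 2F _ _ (cell⁺-last 2F)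
      from 0F 1F ()
      from 1F 1F ()
      from 2F 0F ()

    firstEntry-injective : ∀ i i' → firstEntry i ≡ firstEntry i' → i ≡ i'
    firstEntry-injective 0F 0F _ = refl
    firstEntry-injective 0F 1F e = contradiction e (↑ʳ≢↑ˡ _ _)
    firstEntry-injective 0F 2F e = contradiction e (↑ʳ≢↑ˡ _ _)
    firstEntry-injective 1F 0F e = contradiction e (↑ˡ≢↑ʳ _ _)
    firstEntry-injective 2F 0F e = contradiction e (↑ˡ≢↑ʳ _ _)
    firstEntry-injective 1F 1F _ = refl
    firstEntry-injective 1F 2F e = col-injective col₀ {1F} {2F} (↑ˡ-injective 2 _ _ e)
    firstEntry-injective 2F 1F e = col-injective col₀ {2F} {1F} (↑ˡ-injective 2 _ _ e)
    firstEntry-injective 2F 2F _ = refl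

    lastEntry-injective : ∀ i i' → lastEntry i ≡ lastEntry i' → i ≡ i'
    lastEntry-injective 0F 0F _ = refl
    lastEntry-injective 0F 1F e = contradiction e (↑ˡ≢↑ʳ _ _)
    lastEntry-injective 0F 2F e = contradiction e (↑ˡ≢↑ʳ _ _)
    lastEntry-injective 1F 0F e = contradiction e (↑ʳ≢↑ˡ _ _)
    lastEntry-injective 2F 0F e = contradiction e (↑ʳ≢↑ˡ _ _)
    lastEntry-injective 1F 1F _ = refl
    lastEntry-injective 1F 2F e = contradiction (↑ʳ-injective (3 * k) 0F 1F e) λ ()
    lastEntry-injective 2F 1F e = contradiction (↑ʳ-injective (3 * k) 1F 0F e) λ ()
    lastEntry-injective 2F 2F _ = refl

    first≢middle : ∀ i j₀ → toℕ j₀ ≢ 0 → T⁺ i (col₀ ↑ˡ 1) ≢ T⁺ i (j₀ ↑ˡ 1)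
    first≢middle i j₀ j₀≢0 e = entries i (trans (sym (cell⁺-first i)) (trans e (cell⁺-middle i j₀ j₀≢0)))
      where
      not-col₀ : ∀ i → T i col₀ ≢ T i j₀
      not-col₀ i e = j₀≢0 (trans (cong toℕ (sym (row-injective i e))) toℕ-col₀)
      entries : ∀ i → firstEntry i ≢ T i j₀ ↑ˡ 2
      entries 0F = ↑ʳ≢↑ˡ _ _
      entries 1F = not-col₀ 1F ∘ ↑ˡ-injective 2 _ _
      entries 2F = not-col₀ 2F ∘ ↑ˡ-injective 2 _ _

    first≢last : ∀ i → T⁺ i (col₀ ↑ˡ 1) ≢ T⁺ i last⁺
    first≢last i e = entries i (trans (sym (cell⁺-first i)) (trans e (cell⁺-last i)))
      where
      entries : ∀ i → firstEntry i ≢ lastEntry i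
      entries 0F = ↑ʳ≢↑ˡ _ _
      entries 1F = ↑ˡ≢↑ʳ _ _
      entries 2F = ↑ˡ≢↑ʳ _ _

    middle≢last : ∀ i j₀ → toℕ j₀ ≢ 0 → T⁺ i (j₀ ↑ˡ 1) ≢ T⁺ i last⁺
    middle≢last i j₀ j₀≢0 e = entries i (trans (sym (cell⁺-middle i j₀ j₀≢0)) (trans e (cell⁺-last i)))
      where
      entries : ∀ i → T i j₀ ↑ˡ 2 ≢ lastEntry i
      entries 0F e = j₀≢0 (trans (cong toℕ (row-injective 0F (↑ˡ-injective 2 _ _ e))) toℕ-col₀)
      entries 1F = ↑ˡ≢↑ʳ _ _
      entries 2F = ↑ˡ≢↑ʳ _ _

    row-injective⁺ : ∀ i → Injective _≡_ _≡_ (T⁺ i)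
    row-injective⁺ i {j} {j'} = same-column (column⁺ j) (column⁺ j')
      where
      same-column : ∀ {j j'} → Column⁺ j → Column⁺ j' → T⁺ i j ≡ T⁺ i j' → j ≡ j'
      same-column first first _ = refl
      same-column last last _ = refl
      same-column (middle j₀ j₀≢0) (middle j₀' j₀'≢0) e = cong (_↑ˡ 1) (row-injective i
        (↑ˡ-injective 2 _ _ (trans (sym (cell⁺-middle i j₀ j₀≢0)) (trans e (cell⁺-middle i j₀' j₀'≢0)))))
      same-column first (middle j₀ j₀≢0) e = contradiction e (first≢middle i j₀ j₀≢0)
      same-column (middle j₀ j₀≢0) first e = contradiction (sym e) (first≢middle i j₀ j₀≢0)
      same-column first last e = contradiction e (first≢last i)
      same-column last first e = contradiction (sym e) (first≢last i)
      same-column (middle j₀ j₀≢0) last e = contradiction e (middle≢last i j₀ j₀≢0)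
      same-column last (middle j₀ j₀≢0) e = contradiction (sym e) (middle≢last i j₀ j₀≢0)

    col-injective⁺ : ∀ j → Injective _≡_ _≡_ (λ i → T⁺ i j)
    col-injective⁺ j {i} {i'} = same-row (column⁺ j)
      where
      same-row : ∀ {j} → Column⁺ j → T⁺ i j ≡ T⁺ i' j → i ≡ i'
      same-row first e = firstEntry-injective i i' (trans (sym (cell⁺-first i)) (trans e (cell⁺-first i')))
      same-row (middle j₀ j₀≢0) e = col-injective j₀
        (↑ˡ-injective 2 _ _ (trans (sym (cell⁺-middle i j₀ j₀≢0)) (trans e (cell⁺-middle i' j₀ j₀≢0))))
      same-row last e = lastEntry-injective i i' (trans (sym (cell⁺-last i)) (trans e (cell⁺-last i')))

    binary-T⁺ : Binary T⁺
    binary-T⁺ = binary T⁺ row-injective⁺ col-injective⁺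

    rep-T⁺ : ∀ s → InBand 1 (rep T⁺ s)
    rep-T⁺ s = subst (InBand 1) (sym (rep-rows T⁺ row-injective⁺ s)) (by-symbol (↑-view (3 * k) 2 s))
      where
      by-symbol : ∀ {s} → ↑-View (3 * k) 2 s → InBand 1 (sumF 3 (λ i → 𝟙 (inRow T⁺ i s)))
      by-symbol (↑ˡ-view s₀) = subst (InBand 1) (sym (begin
        sumF 3 (λ i → 𝟙 (inRow T⁺ i (s₀ ↑ˡ 2))) ≡⟨ sumF-cong 3 (λ i → cong 𝟙 (inRow⁺-old i s₀)) ⟩
        sumF 3 (λ i → 𝟙 (inRow T i s₀))         ≡⟨ rep-rows T row-injective s₀ ⟨
        rep T s₀                                ≡⟨ rep-T s₀ ⟩
        2                                       ∎)) (s≤s z≤n , ≤-refl)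
        where open ≡-Reasoning
      by-symbol (↑ʳ-view t) = subst (InBand 1) (sumF-cong 3 (λ i → cong 𝟙 (sym (inRow⁺-new i t)))) (holders t)
        where
        holders : ∀ t → InBand 1 (sumF 3 (λ i → 𝟙 (holdsNew i t)))
        holders 0F = s≤s z≤n , ≤-refl
        holders 1F = ≤-refl , s≤s z≤n

    inRow⁺-lift : ∀ i {i' j j₀} → T⁺ i' j ≡ T i' j₀ ↑ˡ 2 → inRow T⁺ i (T⁺ i' j) ≡ inRow T i (T i' j₀)
    inRow⁺-lift i e = trans (cong (inRow T⁺ i) e) (inRow⁺-old i _)

    rowCol-T⁺ : ∀ i j → InBand 1 (rowCol T⁺ i j)
    rowCol-T⁺ i j = subst (InBand 1) (sym (rowCol-cells T⁺ i j (col-injective⁺ j))) (by-column (column⁺ j))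
      where
      first-row : ∀ {i'} → i' ≢ 0F → inRow T⁺ i (T⁺ i' (col₀ ↑ˡ 1)) ≡ holds i (toℕ i')
      first-row {i'} i'≢0 = trans (inRow⁺-lift i (cell⁺-kept i' col₀ (i'≢0 ∘ proj₁))) (inRow-cell i i' (left col₀<k))
      by-column : ∀ {j} → Column⁺ j → InBand 1 (sumF 3 (λ i' → 𝟙 (inRow T⁺ i (T⁺ i' j))))
      by-column first = subst (InBand 1)
        (sym (cong₂ (λ x y → 𝟙 x + y) (trans (cong (inRow T⁺ i) (cell⁺-first 0F)) (inRow⁺-new i 0F))
               (cong₂ (λ x y → 𝟙 x + (𝟙 y + 0)) (first-row λ ()) (first-row λ ()))))
        (counts i)
        where
        counts : ∀ i → InBand 1 (𝟙 (holdsNew i 0F) + (𝟙 (holds i 1) + (𝟙 (holds i 2) + 0)))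
        counts 0F = s≤s z≤n , ≤-refl
        counts 1F = s≤s z≤n , ≤-refl
        counts 2F = s≤s z≤n , ≤-refl
      by-column (middle j₀ j₀≢0) = subst (InBand 1) (sym (begin
        sumF 3 (λ i' → 𝟙 (inRow T⁺ i (T⁺ i' (j₀ ↑ˡ 1)))) ≡⟨ sumF-cong 3 (λ i' → cong 𝟙 (inRow⁺-lift i (cell⁺-middle i' j₀ j₀≢0))) ⟩
        sumF 3 (λ i' → 𝟙 (inRow T i (T i' j₀)))         ≡⟨ rowCol-cells T i j₀ (col-injective j₀) ⟨
        rowCol T i j₀                                   ≡⟨ rowCol-T i j₀ ⟩
        2                                               ∎)) (s≤s z≤n , ≤-refl)
        where open ≡-Reasoning
      by-column last = subst (InBand 1)
        (sym (cong₂ (λ x y → 𝟙 x + y) (trans (inRow⁺-lift i (cell⁺-last 0F)) (inRow-cell i 0F (left col₀<k)))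
               (cong₂ (λ x y → 𝟙 x + (𝟙 y + 0)) (trans (cong (inRow T⁺ i) (cell⁺-last 1F)) (inRow⁺-new i 0F))
                                                (trans (cong (inRow T⁺ i) (cell⁺-last 2F)) (inRow⁺-new i 1F)))))
        (counts i)
        where
        counts : ∀ i → InBand 1 (𝟙 (holds i 0) + (𝟙 (holdsNew i 0F) + (𝟙 (holdsNew i 1F) + 0)))
        counts 0F = s≤s z≤n , ≤-refl
        counts 1F = s≤s z≤n , ≤-refl
        counts 2F = ≤-refl , s≤s z≤n

    rowRow-T⁺ : ∀ i i' → rowRow T⁺ i i' ≡ rowRow T i i' + countF 2 (λ t → holdsNew i t ∧ holdsNew i' t)
    rowRow-T⁺ i i' = trans (sumF-↑ (3 * k) 2 _) (cong₂ _+_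
      (sumF-cong (3 * k) (λ s₀ → cong 𝟙 (cong₂ _∧_ (inRow⁺-old i s₀) (inRow⁺-old i' s₀))))
      (sumF-cong 2 (λ t → cong 𝟙 (cong₂ _∧_ (inRow⁺-new i t) (inRow⁺-new i' t)))))

    rowRow-T⁺-band : ∀ i i' → i ≢ i' → InBand k (rowRow T⁺ i i')
    rowRow-T⁺-band i i' i≢i' = subst (InBand k) (sym (trans (rowRow-T⁺ i i') (cong (_+ e) (rowRow-T i i' i≢i'))))
      (m≤m+n k e , subst (k + e ≤_) (+-comm k 1) (+-monoʳ-≤ k (shared i i' i≢i')))
      where
      e : ℕ
      e = countF 2 (λ t → holdsNew i t ∧ holdsNew i' t)
      shared : ∀ i i' → i ≢ i' → countF 2 (λ t → holdsNew i t ∧ holdsNew i' t) ≤ 1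
      shared 0F 0F ne = contradiction refl ne
      shared 1F 1F ne = contradiction refl ne
      shared 2F 2F ne = contradiction refl ne
      shared 0F 1F _ = ≤-refl
      shared 0F 2F _ = z≤n
      shared 1F 0F _ = ≤-refl
      shared 1F 2F _ = z≤n
      shared 2F 0F _ = z≤n
      shared 2F 1F _ = z≤n

    inCol⁺-middle : ∀ j₀ → toℕ j₀ ≢ 0 → ∀ x → inCol T⁺ (j₀ ↑ˡ 1) (x ↑ˡ 2) ≡ inCol T j₀ x
    inCol⁺-middle j₀ j₀≢0 x = ≡-from-true to from
      where
      to : inCol T⁺ (j₀ ↑ˡ 1) (x ↑ˡ 2) ≡ true → inCol T j₀ x ≡ true
      to h with inCol-elim T⁺ _ _ h
      ... | i , e = inCol-intro T i j₀ x (↑ˡ-injective 2 _ _ (trans (sym (cell⁺-middle i j₀ j₀≢0)) e))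
      from : inCol T j₀ x ≡ true → inCol T⁺ (j₀ ↑ˡ 1) (x ↑ˡ 2) ≡ true
      from h with inCol-elim T j₀ x h
      ... | i , e = inCol-intro T⁺ i _ _ (trans (cell⁺-middle i j₀ j₀≢0) (cong (_↑ˡ 2) e))

    inCol⁺-middle-new : ∀ j₀ → toℕ j₀ ≢ 0 → ∀ t → inCol T⁺ (j₀ ↑ˡ 1) (3 * k ↑ʳ t) ≡ false
    inCol⁺-middle-new j₀ j₀≢0 t = inCol-false T⁺ _ _ (λ i e → ↑ˡ≢↑ʳ _ _ (trans (sym (cell⁺-middle i j₀ j₀≢0)) e))

    colCol⁺-middle-middle : ∀ j₀ j₀' → toℕ j₀ ≢ 0 → toℕ j₀' ≢ 0 → j₀ ≢ j₀' →
                            colCol T⁺ (j₀ ↑ˡ 1) (j₀' ↑ˡ 1) ≤ 1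
    colCol⁺-middle-middle j₀ j₀' j₀≢0 j₀'≢0 j₀≢j₀' = subst (_≤ 1) (sym (begin
        colCol T⁺ (j₀ ↑ˡ 1) (j₀' ↑ˡ 1)
      ≡⟨ colCol-cells T⁺ _ _ (col-injective⁺ _) ⟩
        sumF 3 (λ i → 𝟙 (inCol T⁺ (j₀ ↑ˡ 1) (T⁺ i (j₀' ↑ˡ 1))))
      ≡⟨ sumF-cong 3 (λ i → cong 𝟙 (trans (cong (inCol T⁺ _) (cell⁺-middle i j₀' j₀'≢0)) (inCol⁺-middle j₀ j₀≢0 _))) ⟩
        sumF 3 (λ i → 𝟙 (inCol T j₀ (T i j₀')))
      ≡⟨ colCol-cells T j₀ j₀' (col-injective j₀') ⟨
        colCol T j₀ j₀'
      ∎)) (colCol-T≤1 j₀ j₀' j₀≢j₀')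
      where open ≡-Reasoning

    colCol⁺-middle-first : ∀ j₀ → toℕ j₀ ≢ 0 → colCol T⁺ (j₀ ↑ˡ 1) (col₀ ↑ˡ 1) ≤ 1
    colCol⁺-middle-first j₀ j₀≢0 = begin
        colCol T⁺ (j₀ ↑ˡ 1) (col₀ ↑ˡ 1)
      ≡⟨ colCol-cells T⁺ _ _ (col-injective⁺ _) ⟩
        sumF 3 (λ i → 𝟙 (inCol T⁺ (j₀ ↑ˡ 1) (T⁺ i (col₀ ↑ˡ 1))))
      ≤⟨ sumF-mono-≤ 3 entry ⟩
        sumF 3 (λ i → 𝟙 (inCol T j₀ (T i col₀)))
      ≡⟨ colCol-cells T j₀ col₀ (col-injective col₀) ⟨
        colCol T j₀ col₀
      ≤⟨ colCol-T≤1 j₀ col₀ (λ j₀≡col₀ → j₀≢0 (trans (cong toℕ j₀≡col₀) toℕ-col₀)) ⟩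
        1
      ∎
      where
      open ≤-Reasoning
      entry : ∀ i → 𝟙 (inCol T⁺ (j₀ ↑ˡ 1) (T⁺ i (col₀ ↑ˡ 1))) ≤ 𝟙 (inCol T j₀ (T i col₀))
      entry 0F = subst (_≤ 𝟙 (inCol T j₀ (T 0F col₀)))
        (cong 𝟙 (sym (trans (cong (inCol T⁺ _) (cell⁺-first 0F)) (inCol⁺-middle-new j₀ j₀≢0 0F)))) z≤n
      entry 1F = ≤-reflexive (cong 𝟙 (trans (cong (inCol T⁺ _) (cell⁺-first 1F)) (inCol⁺-middle j₀ j₀≢0 _)))
      entry 2F = ≤-reflexive (cong 𝟙 (trans (cong (inCol T⁺ _) (cell⁺-first 2F)) (inCol⁺-middle j₀ j₀≢0 _)))

    colCol⁺-middle-last : ∀ j₀ → toℕ j₀ ≢ 0 → colCol T⁺ (j₀ ↑ˡ 1) last⁺ ≤ 1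
    colCol⁺-middle-last j₀ j₀≢0 = subst (_≤ 1) (sym (colCol-cells T⁺ _ _ (col-injective⁺ _))) (countF-≤1-at 3 _ 0F only-row₀)
      where
      not-new : ∀ i → i ≢ 0F → inCol T⁺ (j₀ ↑ˡ 1) (T⁺ i last⁺) ≡ false
      not-new 0F ne = contradiction refl ne
      not-new 1F _ = trans (cong (inCol T⁺ _) (cell⁺-last 1F)) (inCol⁺-middle-new j₀ j₀≢0 0F)
      not-new 2F _ = trans (cong (inCol T⁺ _) (cell⁺-last 2F)) (inCol⁺-middle-new j₀ j₀≢0 1F)
      only-row₀ : ∀ i → inCol T⁺ (j₀ ↑ˡ 1) (T⁺ i last⁺) ≡ true → i ≡ 0F
      only-row₀ 0F _ = refl
      only-row₀ 1F h = contradiction (trans (sym h) (not-new 1F λ ())) λ ()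
      only-row₀ 2F h = contradiction (trans (sym h) (not-new 2F λ ())) λ ()

    colCol⁺-first-last : colCol T⁺ (col₀ ↑ˡ 1) last⁺ ≤ 1
    colCol⁺-first-last = subst (_≤ 1) (sym (colCol-cells T⁺ _ _ (col-injective⁺ _))) (countF-≤1-at 3 _ 1F only-row₁)
      where
      absent : ∀ s → (∀ i → firstEntry i ≢ s) → inCol T⁺ (col₀ ↑ˡ 1) s ≡ false
      absent s never = inCol-false T⁺ _ s (λ i e → never i (trans (sym (cell⁺-first i)) e))
      no-T₀₀ : ∀ i → firstEntry i ≢ T 0F col₀ ↑ˡ 2
      no-T₀₀ 0F = ↑ʳ≢↑ˡ _ _
      no-T₀₀ 1F = (λ ()) ∘ col-injective col₀ {1F} {0F} ∘ ↑ˡ-injective 2 _ _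
      no-T₀₀ 2F = (λ ()) ∘ col-injective col₀ {2F} {0F} ∘ ↑ˡ-injective 2 _ _
      no-new₁ : ∀ i → firstEntry i ≢ new₁
      no-new₁ 0F = (λ ()) ∘ ↑ʳ-injective (3 * k) 0F 1F
      no-new₁ 1F = ↑ˡ≢↑ʳ _ _
      no-new₁ 2F = ↑ˡ≢↑ʳ _ _
      only-row₁ : ∀ i → inCol T⁺ (col₀ ↑ˡ 1) (T⁺ i last⁺) ≡ true → i ≡ 1F
      only-row₁ 0F h = contradiction (trans (sym h) (trans (cong (inCol T⁺ _) (cell⁺-last 0F)) (absent _ no-T₀₀))) λ ()
      only-row₁ 1F _ = refl
      only-row₁ 2F h = contradiction (trans (sym h) (trans (cong (inCol T⁺ _) (cell⁺-last 2F)) (absent _ no-new₁))) λ ()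

    colCol-T⁺≤1 : ∀ j j' → j ≢ j' → colCol T⁺ j j' ≤ 1
    colCol-T⁺≤1 j j' = by-columns (column⁺ j) (column⁺ j')
      where
      flipped : ∀ {j j'} → colCol T⁺ j' j ≤ 1 → colCol T⁺ j j' ≤ 1
      flipped = subst (_≤ 1) (colCol-sym T⁺ _ _)
      by-columns : ∀ {j j'} → Column⁺ j → Column⁺ j' → j ≢ j' → colCol T⁺ j j' ≤ 1
      by-columns first first ne = contradiction refl ne
      by-columns last last ne = contradiction refl ne
      by-columns (middle j₀ p) (middle j₀' p') ne = colCol⁺-middle-middle j₀ j₀' p p' (ne ∘ cong (_↑ˡ 1))
      by-columns (middle j₀ p) first _ = colCol⁺-middle-first j₀ p
      by-columns first (middle j₀ p) _ = flipped (colCol⁺-middle-first j₀ p)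
      by-columns (middle j₀ p) last _ = colCol⁺-middle-last j₀ p
      by-columns last (middle j₀ p) _ = flipped (colCol⁺-middle-last j₀ p)
      by-columns first last _ = colCol⁺-first-last
      by-columns last first _ = flipped colCol⁺-first-last

    nearTripleArray-T⁺ : NearTripleArray 3 (2 * k + 1) (3 * k + 2) T⁺
    nearTripleArray-T⁺ = nearTripleArray T⁺ binary-T⁺ rep-T⁺ rowCol-T⁺ rowRow-T⁺-band
      (λ j j' j≢j' → z≤n , colCol-T⁺≤1 j j' j≢j')

lemma5p12 : (k : ℕ) .{{_ : NonZero k}} → 3 ≤ k →
    Σ (Design 3 (2 * k) (3 * k)) (IsT k)
    × (∀ T → IsT k T →
         NearTripleArray 3 (2 * k) (3 * k) T
         × NearTripleArray 3 (2 * k + 1) (3 * k + 2) (T' k T))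
lemma5p12 k 3≤k = (T₀ , isT₀) , λ T isT → nearTripleArray-T T isT , nearTripleArray-T⁺ T isT
  where open DesignT k 3≤k
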